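{- Let $S$ be a 3-SAT instance and $G(S)$ the graph constructed from it as described in the context. Then for every clause $C_j$ of $S$, every connectivity basis of $G(S)$ contains exactly two of the vertices $c_j^3,c_j^4,c_j^5$.
   Context: All graphs are finite, simple and undirected. For distinct vertices $v,w$, $\kappa(v,w)$ is the maximum number of internally vertex-disjoint $v$–$w$ paths; $\kappa(v,v)=\infty$. A set $W=\{w_1,\ldots,w_k\}$ is resolving if the vectors $[\kappa(v,w_1),\ldots,\kappa(v,w_k)]$, $v\in V(G)$, are pairwise distinct; a connectivity basis is a resolving set of minimum size, and $\operatorname{cdim}(G)$ is its size. Construction: $S$ is a 3-SAT instance with variables $X_1,\ldots,X_n$ and clauses $C_1,\ldots,C_m$ (each clause a disjunction of literals $X_i$ or $\overline{X}_i$); every variable occurs in some clause. For each variable $X_i$ take vertices $x_i^1,\ldots,x_i^5$ with edges $x_i^1x_i^2, x_i^1x_i^3, x_i^1x_i^4, x_i^1x_i^5, x_i^2x_i^3, x_i^2x_i^4, x_i^2x_i^5, x_i^3x_i^4, x_i^3x_i^5$ (i.e. $K_5$ minus the edge $x_i^4x_i^5$). For each clause $C_j$ take vertices $c_j^1,\ldots,c_j^6$ with edges $c_j^ac_j^b$ for $a\in\{1,2\}$, $b\in\{3,4,5\}$, the triangle $c_j^3c_j^4, c_j^3c_j^5, c_j^4c_j^5$, and $c_j^6c_j^3, c_j^6c_j^4, c_j^6c_j^5$. If $X_i$ occurs as a positive literal in $C_j$, add edges $c_j^1x_i^1, c_j^2x_i^1, c_j^2x_i^2$; if $X_i$ occurs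 as a negative literal in $C_j$, add edges $c_j^1x_i^1, c_j^1x_i^2, c_j^2x_i^2$. For every pair of distinct clauses $C_j\neq C_k$ add the edges $c_j^1c_k^1, c_j^1c_k^2, c_j^2c_k^1, c_j^2c_k^2$. No other edges. The resulting graph is $G(S)$; it is assumed to be connected. -}

module Defs where

open import Data.Nat using (ℕ; _≤_)
open import Data.Fin using (Fin; zero; suc; #_)
open import Data.Bool using (Bool; true; false)
open import Data.Product using (Σ; ∃; _×_; _,_)
open import Data.Sum using (_⊎_)
open import Data.List using (List; []; _∷_; _++_)
open import Data.Vec using (Vec)
open import Data.Vec.Membership.Propositional using (_∈_)
open import Data.List.Relation.Unary.Linked using (Linked)
open import Data.List.Relation.Unary.Unique.Propositional using (Unique)
open import Data.List.Relation.Binary.Disjoint.Propositional using (Disjoint)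
open import Relation.Binary.PropositionalEquality using (_≡_; _≢_)
open import Relation.Nullary using (¬_)
open import Function.Definitions using (Injective)

module _ {V : Set} (A : V → V → Set) where

  -- I is the list of interior vertices of a v–w path:
  -- v ∷ I ++ [w] is a sequence of pairwise distinct vertices,
  -- consecutive ones adjacent.
  IsPath : V → V → List V → Set
  IsPath v w I = Linked A (v ∷ I ++ w ∷ []) × Unique (v ∷ I ++ w ∷ [])

  Connected : Set
  Connected = ∀ u v → u ≢ v → ∃ λ I → IsPath u v I

  DisjointPaths : V → V → ℕ → Set
  DisjointPaths v w k =
    Σ (Fin k → List V) λ P →
      (∀ i → IsPath v w (P i)) ×
      (∀ i j → i ≢ j → P i ≢ P j × Disjoint (P i) (P j))

_∈W_ : ∀ {V : Set} → V → ∀ {k} → (Fin k → V) → Set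
v ∈W W = ∃ λ i → W i ≡ v

data ℕ∞ : Set where
  fin : ℕ → ℕ∞
  ∞   : ℕ∞

module _ {V : Set} (A : V → V → Set) where

  data κ : V → V → ℕ∞ → Set where
    κ-refl : ∀ {v} → κ v v ∞
    κ-max  : ∀ {v w k} → v ≢ w → DisjointPaths A v w k →
             (∀ k′ → DisjointPaths A v w k′ → k′ ≤ k) → κ v w (fin k)

  Resolving : ∀ {k} → (Fin k → V) → Set
  Resolving {k} W = ∀ u v →
    (∀ i a b → κ u (W i) a → κ v (W i) b → a ≡ b) → u ≡ v

  ConnectivityBasis : ∀ {k} → (Fin k → V) → Set
  ConnectivityBasis {k} W =
    Injective _≡_ _≡_ W × Resolving W ×
    (∀ k′ (W′ : Fin k′ → V) → Injective _≡_ _≡_ W′ → Resolving W′ → k ≤ k′)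


-- 3-SAT instances: n variables, m clauses, each clause 3 literals.
-- A literal is (i , true) for X_i and (i , false) for ¬X_i.

Literal : ℕ → Set
Literal n = Fin n × Bool

Clause : ℕ → Set
Clause n = Vec (Literal n) 3

-- Vertices of G(S). Indices are 0-based:
-- x i a  is x_{i+1}^{a+1},  c j a  is c_{j+1}^{a+1}.
data Vtx (n m : ℕ) : Set where
  x : Fin n → Fin 5 → Vtx n m
  c : Fin m → Fin 6 → Vtx n m

low : Fin 2 → Fin 6
low zero = # 0
low (suc _) = # 1

mid : Fin 3 → Fin 6
mid zero = # 2
mid (suc zero) = # 3
mid (suc (suc _)) = # 4

data Edge {n m : ℕ} (S : Fin m → Clause n) : Vtx n m → Vtx n m → Set where
  -- variable gadget: K5 minus x^4 x^5
  x12 : ∀ {i} → Edge S (x i (# 0)) (x i (# 1))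
  x13 : ∀ {i} → Edge S (x i (# 0)) (x i (# 2))
  x14 : ∀ {i} → Edge S (x i (# 0)) (x i (# 3))
  x15 : ∀ {i} → Edge S (x i (# 0)) (x i (# 4))
  x23 : ∀ {i} → Edge S (x i (# 1)) (x i (# 2))
  x24 : ∀ {i} → Edge S (x i (# 1)) (x i (# 3))
  x25 : ∀ {i} → Edge S (x i (# 1)) (x i (# 4))
  x34 : ∀ {i} → Edge S (x i (# 2)) (x i (# 3))
  x35 : ∀ {i} → Edge S (x i (# 2)) (x i (# 4))
  cab : ∀ {j} (a : Fin 2) (b : Fin 3) → Edge S (c j (low a)) (c j (mid b))
  c34 : ∀ {j} → Edge S (c j (# 2)) (c j (# 3))
  c35 : ∀ {j} → Edge S (c j (# 2)) (c j (# 4))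
  c45 : ∀ {j} → Edge S (c j (# 3)) (c j (# 4))
  c6b : ∀ {j} (b : Fin 3) → Edge S (c j (# 5)) (c j (mid b))
  pos11 : ∀ {i j} → (i , true) ∈ S j → Edge S (c j (# 0)) (x i (# 0))
  pos21 : ∀ {i j} → (i , true) ∈ S j → Edge S (c j (# 1)) (x i (# 0))
  pos22 : ∀ {i j} → (i , true) ∈ S j → Edge S (c j (# 1)) (x i (# 1))
  neg11 : ∀ {i j} → (i , false) ∈ S j → Edge S (c j (# 0)) (x i (# 0))
  neg12 : ∀ {i j} → (i , false) ∈ S j → Edge S (c j (# 0)) (x i (# 1))
  neg22 : ∀ {i j} → (i , false) ∈ S j → Edge S (c j (# 1)) (x i (# 1))
  cc : ∀ {j k} → j ≢ k → (a b : Fin 2) → Edge S (c j (low a)) (c k (low b))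

Adj : ∀ {n m} (S : Fin m → Clause n) → Vtx n m → Vtx n m → Set
Adj S u v = Edge S u v ⊎ Edge S v u

AllVarsOccur : ∀ {n m} → (Fin m → Clause n) → Set
AllVarsOccur {n} {m} S = ∀ (i : Fin n) → ∃ λ (j : Fin m) → ∃ λ b → (i , b) ∈ S j

ExactlyTwoMid : ∀ {n m k} → (Fin k → Vtx n m) → Fin m → Set
ExactlyTwoMid {n} {m} W j =
  ∃ λ (t : Fin 3) → ¬ (c j (mid t) ∈W W) ×
    (∀ t′ → t′ ≢ t → c j (mid t′) ∈W W)

{-# OPTIONS --safe #-}
module Submission where

-- If two of c³, c⁴, c⁵ were missing from W, the automorphism of G(S) swapping them would fix
-- W pointwise; as κ is invariant under automorphisms, the two would have the same κ-vector.
-- If all three were in W, c⁵ would be redundant. Indeed κ(c⁵, c³) = κ(c⁵, c⁴) = 5 (the edge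
-- and the paths through c¹, c², c⁶ and the third triangle vertex), while a vertex off the
-- triangle has fewer than 5 disjoint paths to c³ (they are cut by c¹, c², c⁴, c⁵, or by the
-- neighbours of c⁶) and, by the swaps, the same κ to c³, c⁴ and c⁵. Hence the κ-values at c³
-- and c⁴ determine those at c⁵, and W without c⁵ is still resolving, against minimality.

open import Defs
open import Data.Nat using (ℕ; suc; _≤_; s≤s)
open import Data.Nat.Properties using (≤-antisym; n≮n)
open import Data.Fin using (Fin; zero; suc; #_; punchIn; punchOut)
open import Data.Fin.Properties
  using (injective⇒≤; punchIn-injective; punchIn-punchOut; any?; ¬∀⟶∃¬)
  renaming (_≟_ to _≟ᶠ_)
open import Data.Fin.Permutation using (Permutation′; _⟨$⟩ʳ_; inverseˡ; transpose; flip; id)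
open import Data.Bool using (if_then_else_)
open import Data.Unit using (⊤; tt)
open import Data.Vec using ([]; _∷_) renaming (lookup to lookupᵥ)
open import Data.Product using (∃; _×_; _,_; proj₁; proj₂)
open import Data.Sum using (_⊎_; inj₁; inj₂; [_,_]; swap)
open import Data.Empty using (⊥; ⊥-elim)
open import Data.List using (List; []; _∷_; _++_; map)
open import Data.List.Properties using (map-++; map-injective; ∷-injectiveˡ)
open import Data.List.Membership.Propositional using (_∈_; _∉_)
open import Data.List.Membership.Propositional.Properties using (∈-map⁻; ∈-++⁺ˡ; ∈-++⁺ʳ)
open import Data.List.Relation.Unary.Any using (here; there)
open import Data.List.Relation.Unary.All using ([]; _∷_; lookup)
open import Data.List.Relation.Unary.All.Properties using (++⁻ˡ; ++⁻ʳ)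
open import Data.List.Relation.Unary.Linked using (Linked; [-]; _∷_)
import Data.List.Relation.Unary.Linked as Linked
import Data.List.Relation.Unary.Linked.Properties as Linkedₚ
import Data.List.Relation.Unary.Unique.Propositional.Properties as Unique
open import Data.List.Relation.Unary.Unique.Propositional using (Unique; []; _∷_)
open import Data.List.Relation.Binary.Disjoint.Propositional using (Disjoint)
open import Function using (_∘_)
open import Function.Bundles using (Injection)
open import Function.Properties.Inverse using (↔⇒↣)
open import Function.Definitions using (Injective)
open import Relation.Binary.PropositionalEquality
  using (_≡_; _≢_; refl; sym; trans; cong; cong₂; subst; subst₂; ≢-sym)
open import Relation.Nullary using (¬_; Dec; yes; no; does)
open import Relation.Nullary.Decidable using (dec-true; dec-false; map′; _×-dec_; _⊎-dec_)
open import Relation.Binary.Definitions using (DecidableEquality)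

module Connectivity {V : Set} (A : V → V → Set) where

  Agree : V → V → V → Set
  Agree u v w = ∀ a b → κ A u w a → κ A v w b → a ≡ b

  Agree-sym : ∀ {u v w} → Agree u v w → Agree v u w
  Agree-sym ag a b κv κu = sym (ag b a κu κv)

  κ-functional : ∀ {v w a b} → κ A v w a → κ A v w b → a ≡ b
  κ-functional κ-refl κ-refl = refl
  κ-functional κ-refl (κ-max v≢v _ _) = ⊥-elim (v≢v refl)
  κ-functional (κ-max v≢v _ _) κ-refl = ⊥-elim (v≢v refl)
  κ-functional (κ-max _ ps max) (κ-max _ qs max′) = cong fin (≤-antisym (max′ _ ps) (max _ qs))

  κ-∞⇒≡ : ∀ {v w} → κ A v w ∞ → v ≡ w
  κ-∞⇒≡ κ-refl = refl

  κ-fin⇒disjointPaths : ∀ {v w k} → κ A v w (fin k) → DisjointPaths A v w k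
  κ-fin⇒disjointPaths (κ-max _ ps _) = ps

  ≡⇒Agree : ∀ {u v w} → u ≡ v → Agree u v w
  ≡⇒Agree refl a b = κ-functional

  agree-at-self⇒≡ : ∀ {v w b} → Agree w v w → κ A v w b → v ≡ w
  agree-at-self⇒≡ {b = b} ag κv = κ-∞⇒≡ (subst (κ A _ _) (sym (ag ∞ b κ-refl κv)) κv)

  start≢end : ∀ {v w I} → IsPath A v w I → v ≢ w
  start≢end {I = I} (_ , v∉ ∷ _) = lookup (++⁻ʳ I v∉) (here refl)

  start∉interior : ∀ {v w I} → IsPath A v w I → v ∉ I
  start∉interior {I = I} (_ , v∉ ∷ _) v∈I = lookup (++⁻ˡ I v∉) v∈I refl

  end∉interior : ∀ {v w I} → IsPath A v w I → w ∉ I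
  end∉interior {I = I} (_ , _ ∷ unique) = last∉init I unique
    where
    last∉init : ∀ {w} I → Unique (I ++ w ∷ []) → w ∉ I
    last∉init (u ∷ I) (u∉ ∷ _) (here refl) = lookup u∉ (∈-++⁺ʳ I (here refl)) refl
    last∉init (u ∷ I) (_ ∷ unique) (there w∈I) = last∉init I unique w∈I

  data LastStep (v w : V) : List V → Set where
    direct : A v w → LastStep v w []
    via    : ∀ I {u} → Linked A (v ∷ I ++ u ∷ []) → A u w → LastStep v w (I ++ u ∷ [])

  lastStep : ∀ {v w} I → Linked A (v ∷ I ++ w ∷ []) → LastStep v w I
  lastStep [] (vw ∷ _) = direct vw
  lastStep (u ∷ I) (vu ∷ linked) with lastStep I linked
  ... | direct uw = via [] (vu ∷ [-]) uw
  ... | via I′ linked′ u′w = via (u ∷ I′) (vu ∷ linked′) u′w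

  -- The single-edge path v w counts as meeting f at v, so a cut may contain v when v is
  -- adjacent to w.
  Meets : ∀ {m} → (Fin m → V) → V → List V → Set
  Meets f v I = ∃ λ t → f t ∈ I ⊎ (I ≡ [] × f t ≡ v)

  Cut : ∀ {m} → (Fin m → V) → V → V → Set
  Cut f v w = ∀ {I} → IsPath A v w I → Meets f v I

  cut⇒disjointPaths≤ : ∀ {m k v w} (f : Fin m → V) → Cut f v w →
                       DisjointPaths A v w k → k ≤ m
  cut⇒disjointPaths≤ {m} {k} {v} f cut (P , paths , disjoint) = injective⇒≤ slot-injective
    where
    slot : Fin k → Fin m
    slot i = proj₁ (cut (paths i))

    slot-injective : Injective _≡_ _≡_ slot
    slot-injective {i} {i′} eq with i ≟ᶠ i′
    ... | yes i≡i′ = i≡i′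
    ... | no i≢i′ = ⊥-elim (collide (proj₂ (cut (paths i))) (proj₂ (cut (paths i′))) eq)
      where
      collide : ∀ {t t′} → f t ∈ P i ⊎ (P i ≡ [] × f t ≡ v) →
                f t′ ∈ P i′ ⊎ (P i′ ≡ [] × f t′ ≡ v) → t ≢ t′
      collide (inj₁ ∈P) (inj₁ ∈P′) refl = proj₂ (disjoint i i′ i≢i′) (∈P , ∈P′)
      collide (inj₁ ∈P) (inj₂ (_ , refl)) refl = start∉interior (paths i) ∈P
      collide (inj₂ (_ , refl)) (inj₁ ∈P′) refl = start∉interior (paths i′) ∈P′
      collide (inj₂ (P≡[] , _)) (inj₂ (P′≡[] , _)) refl =
        proj₁ (disjoint i i′ i≢i′) (trans P≡[] (sym P′≡[]))

  neighbours⇒disjointPaths≤ : ∀ {m k v w} (f : Fin m → V) →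
                              (∀ {u} → A u w → u ≢ w → ∃ λ t → f t ≡ u) →
                              DisjointPaths A v w k → k ≤ m
  neighbours⇒disjointPaths≤ {v = v} {w} f covers = cut⇒disjointPaths≤ f penultimate
    where
    penultimate : Cut f v w
    penultimate path@(linked , _) with lastStep _ linked
    ... | direct vw = let t , e = covers vw (start≢end {I = []} path) in t , inj₂ (refl , e)
    ... | via I {u} _ uw =
      let t , e = covers uw (λ { refl → end∉interior {I = I ++ u ∷ []} path u∈I })
      in t , inj₁ (subst (_∈ _) (sym e) u∈I)
      where u∈I = ∈-++⁺ʳ I (here refl)

  fan⇒disjointPaths : ∀ {r v w} → v ≢ w → A v w → (f : Fin r → V) → Injective _≡_ _≡_ f →
                      (∀ t → A v (f t) × A (f t) w × v ≢ f t × f t ≢ w) →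
                      DisjointPaths A v w (suc r)
  fan⇒disjointPaths {r} {v} {w} v≢w vw f f-injective spoke = P , isPath , disjoint
    where
    P : Fin (suc r) → List V
    P zero = []
    P (suc t) = f t ∷ []

    isPath : ∀ i → IsPath A v w (P i)
    isPath zero = vw ∷ [-] , (v≢w ∷ []) ∷ [] ∷ []
    isPath (suc t) =
      let vf , fw , v≢f , f≢w = spoke t
      in vf ∷ fw ∷ [-] , (v≢f ∷ v≢w ∷ []) ∷ (f≢w ∷ []) ∷ [] ∷ []

    disjoint : ∀ i i′ → i ≢ i′ → P i ≢ P i′ × Disjoint (P i) (P i′)
    disjoint zero zero 0≢0 = ⊥-elim (0≢0 refl)
    disjoint zero (suc _) _ = (λ ()) , λ { (() , _) }
    disjoint (suc _) zero _ = (λ ()) , λ { (_ , ()) }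
    disjoint (suc t) (suc t′) t≢t′ =
      (λ eq → t≢t′ (cong suc (f-injective (∷-injectiveˡ eq)))) ,
      λ { (here refl , here eq) → t≢t′ (cong suc (f-injective eq))
        ; (there () , _)
        ; (_ , there ()) }

  basis-irredundant : ∀ {k} {W : Fin k → V} → ConnectivityBasis A W → ∀ p →
                      (∀ u v → (∀ i → p ≢ i → Agree u v (W i)) → Agree u v (W p)) → ⊥
  basis-irredundant {suc k} {W} (injective , resolving , minimal) p redundant =
    n≮n k (minimal k (W ∘ punchIn p) (punchIn-injective p _ _ ∘ injective) resolving′)
    where
    resolving′ : Resolving A (W ∘ punchIn p)
    resolving′ u v agree′ = resolving u v agree
      where
      agree-off-p : ∀ i → p ≢ i → Agree u v (W i)
      agree-off-p i p≢i = subst (Agree u v ∘ W) (punchIn-punchOut p≢i) (agree′ (punchOut p≢i))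

      agree : ∀ i → Agree u v (W i)
      agree i with p ≟ᶠ i
      ... | yes refl = redundant u v agree-off-p
      ... | no p≢i = agree-off-p i p≢i

module _ {V V′ : Set} {A : V → V → Set} {B : V′ → V′ → Set} {φ : V → V′}
         (φ-injective : Injective _≡_ _≡_ φ) (φ-hom : ∀ {u v} → A u v → B (φ u) (φ v)) where

  map-isPath : ∀ {v w I} → IsPath A v w I → IsPath B (φ v) (φ w) (map φ I)
  map-isPath {v} {w} {I} (linked , unique) =
    subst (Linked B) map-path (Linkedₚ.map⁺ (Linked.map φ-hom linked)) ,
    subst Unique map-path (Unique.map⁺ φ-injective unique)
    where
    map-path : map φ (v ∷ I ++ w ∷ []) ≡ φ v ∷ map φ I ++ φ w ∷ []
    map-path = cong (φ v ∷_) (map-++ φ I (w ∷ []))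

  map-disjoint : ∀ {xs ys} → Disjoint xs ys → Disjoint (map φ xs) (map φ ys)
  map-disjoint xs#ys (∈xs , ∈ys) with ∈-map⁻ φ ∈xs | ∈-map⁻ φ ∈ys
  ... | u , u∈xs , refl | u′ , u′∈ys , φu≡φu′ =
    xs#ys (u∈xs , subst (_∈ _) (sym (φ-injective φu≡φu′)) u′∈ys)

  map-disjointPaths : ∀ {v w k} → DisjointPaths A v w k → DisjointPaths B (φ v) (φ w) k
  map-disjointPaths (P , paths , disjoint) =
    map φ ∘ P , map-isPath ∘ paths ,
    λ i i′ i≢i′ → let P≢P′ , P#P′ = disjoint i i′ i≢i′
                  in P≢P′ ∘ map-injective φ-injective , map-disjoint P#P′

module Automorphism {V : Set} {A : V → V → Set} (σ σ⁻¹ : V → V)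
                    (σ⁻¹∘σ : ∀ v → σ⁻¹ (σ v) ≡ v) (σ∘σ⁻¹ : ∀ v → σ (σ⁻¹ v) ≡ v)
                    (σ-hom : ∀ {u v} → A u v → A (σ u) (σ v))
                    (σ⁻¹-hom : ∀ {u v} → A u v → A (σ⁻¹ u) (σ⁻¹ v)) where

  open Connectivity A

  σ-injective : Injective _≡_ _≡_ σ
  σ-injective {u} {v} eq = trans (sym (σ⁻¹∘σ u)) (trans (cong σ⁻¹ eq) (σ⁻¹∘σ v))

  σ⁻¹-injective : Injective _≡_ _≡_ σ⁻¹
  σ⁻¹-injective {u} {v} eq = trans (sym (σ∘σ⁻¹ u)) (trans (cong σ eq) (σ∘σ⁻¹ v))

  κ-invariant : ∀ {v w a} → κ A v w a → κ A (σ v) (σ w) a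
  κ-invariant κ-refl = κ-refl
  κ-invariant {v} {w} (κ-max v≢w ps maximal) =
    κ-max (v≢w ∘ σ-injective) (map-disjointPaths σ-injective σ-hom ps) λ k qs →
      maximal k (subst₂ (λ v′ w′ → DisjointPaths A v′ w′ k) (σ⁻¹∘σ v) (σ⁻¹∘σ w)
                        (map-disjointPaths σ⁻¹-injective σ⁻¹-hom qs))

  resolving⇒fixes-all : ∀ {k} {W : Fin k → V} → Resolving A W →
                        (∀ i → σ (W i) ≡ W i) → ∀ v → σ v ≡ v
  resolving⇒fixes-all {W = W} resolving fixes v = resolving (σ v) v λ i a b κσv κv →
    κ-functional κσv (subst (λ w → κ A (σ v) w b) (fixes i) (κ-invariant κv))

transpose-matchˡ : ∀ {n} (i j : Fin n) → transpose i j ⟨$⟩ʳ i ≡ j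
transpose-matchˡ i j rewrite dec-true (i ≟ᶠ i) refl = refl

transpose-fixes : ∀ {n} {i j k : Fin n} → k ≢ i → k ≢ j → transpose i j ⟨$⟩ʳ k ≡ k
transpose-fixes {i = i} {j} {k} k≢i k≢j
  rewrite dec-false (k ≟ᶠ i) k≢i | dec-false (k ≟ᶠ j) k≢j = refl

mid-injective : Injective _≡_ _≡_ mid
mid-injective {zero} {zero} _ = refl
mid-injective {zero} {suc zero} ()
mid-injective {zero} {suc (suc zero)} ()
mid-injective {suc zero} {zero} ()
mid-injective {suc zero} {suc zero} _ = refl
mid-injective {suc zero} {suc (suc zero)} ()
mid-injective {suc (suc zero)} {zero} ()
mid-injective {suc (suc zero)} {suc zero} ()
mid-injective {suc (suc zero)} {suc (suc zero)} _ = refl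

permute-≢ : ∀ {n} (π : Permutation′ n) {i j} → i ≢ j → π ⟨$⟩ʳ i ≢ π ⟨$⟩ʳ j
permute-≢ π i≢j = i≢j ∘ Injection.injective (↔⇒↣ π)

permuteMid : Permutation′ 3 → Fin 6 → Fin 6
permuteMid π (suc (suc zero)) = mid (π ⟨$⟩ʳ # 0)
permuteMid π (suc (suc (suc zero))) = mid (π ⟨$⟩ʳ # 1)
permuteMid π (suc (suc (suc (suc zero)))) = mid (π ⟨$⟩ʳ # 2)
permuteMid π a = a

permuteMid-low : ∀ π a → permuteMid π (low a) ≡ low a
permuteMid-low π zero = refl
permuteMid-low π (suc _) = refl

permuteMid-mid : ∀ π b → permuteMid π (mid b) ≡ mid (π ⟨$⟩ʳ b)
permuteMid-mid π zero = refl
permuteMid-mid π (suc zero) = refl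
permuteMid-mid π (suc (suc zero)) = refl

permuteMid-fixes : ∀ π a → (∀ b → mid b ≡ a → π ⟨$⟩ʳ b ≡ b) → permuteMid π a ≡ a
permuteMid-fixes π (suc (suc zero)) fixes = cong mid (fixes (# 0) refl)
permuteMid-fixes π (suc (suc (suc zero))) fixes = cong mid (fixes (# 1) refl)
permuteMid-fixes π (suc (suc (suc (suc zero)))) fixes = cong mid (fixes (# 2) refl)
permuteMid-fixes π zero _ = refl
permuteMid-fixes π (suc zero) _ = refl
permuteMid-fixes π (suc (suc (suc (suc (suc zero))))) _ = refl

permuteMid-inverse : ∀ π a → permuteMid (flip π) (permuteMid π a) ≡ a
permuteMid-inverse π (suc (suc zero)) =
  trans (permuteMid-mid (flip π) _) (cong mid (inverseˡ π))
permuteMid-inverse π (suc (suc (suc zero))) =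
  trans (permuteMid-mid (flip π) _) (cong mid (inverseˡ π))
permuteMid-inverse π (suc (suc (suc (suc zero)))) =
  trans (permuteMid-mid (flip π) _) (cong mid (inverseˡ π))
permuteMid-inverse π zero = refl
permuteMid-inverse π (suc zero) = refl
permuteMid-inverse π (suc (suc (suc (suc (suc zero))))) = refl

swapAt : ∀ {m} → Fin m → Fin 3 → Fin 3 → Fin m → Permutation′ 3
swapAt j s t j′ = if does (j′ ≟ᶠ j) then transpose s t else id

IsLow IsMid : Fin 6 → Set
IsLow a = ∃ λ a′ → low a′ ≡ a
IsMid a = ∃ λ b → mid b ≡ a

module _ {n m : ℕ} where

  _≟ᵥ_ : DecidableEquality (Vtx n m)
  x i a ≟ᵥ x i′ a′ =
    map′ (λ (i≡i′ , a≡a′) → cong₂ x i≡i′ a≡a′) (λ { refl → refl , refl }) (i ≟ᶠ i′ ×-dec a ≟ᶠ a′)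
  x _ _ ≟ᵥ c _ _ = no λ ()
  c _ _ ≟ᵥ x _ _ = no λ ()
  c j a ≟ᵥ c j′ a′ =
    map′ (λ (j≡j′ , a≡a′) → cong₂ c j≡j′ a≡a′) (λ { refl → refl , refl }) (j ≟ᶠ j′ ×-dec a ≟ᶠ a′)

  _∈W?_ : ∀ {k} (v : Vtx n m) (W : Fin k → Vtx n m) → Dec (v ∈W W)
  v ∈W? W = any? λ i → W i ≟ᵥ v

  c-injectiveʳ : ∀ {j j′ a a′} → c {n} {m} j a ≡ c j′ a′ → a ≡ a′
  c-injectiveʳ refl = refl

  relabel : (Fin m → Permutation′ 3) → Vtx n m → Vtx n m
  relabel ρ (x i a) = x i a
  relabel ρ (c j a) = c j (permuteMid (ρ j) a)

  relabel-inverse : ∀ ρ v → relabel (flip ∘ ρ) (relabel ρ v) ≡ v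
  relabel-inverse ρ (x i a) = refl
  relabel-inverse ρ (c j a) = cong (c j) (permuteMid-inverse (ρ j) a)

  Outer : Vtx n m → Set
  Outer (x _ _) = ⊤
  Outer (c _ a) = IsLow a

  data EdgeKind : Vtx n m → Vtx n m → Set where
    outer  : ∀ {u v} → Outer u → Outer v → EdgeKind u v
    gadget : ∀ {j a a′} → IsMid a ⊎ IsMid a′ → EdgeKind (c j a) (c j a′)

  EdgeKind-sym : ∀ {u v} → EdgeKind u v → EdgeKind v u
  EdgeKind-sym (outer u-outer v-outer) = outer v-outer u-outer
  EdgeKind-sym (gadget mid-end) = gadget (swap mid-end)

  module _ (S : Fin m → Clause n) where

    mid-adj : ∀ {j b b′} → b ≢ b′ → Adj S (c j (mid b)) (c j (mid b′))
    mid-adj {b = zero} {zero} b≢b′ = ⊥-elim (b≢b′ refl)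
    mid-adj {b = zero} {suc zero} _ = inj₁ c34
    mid-adj {b = zero} {suc (suc zero)} _ = inj₁ c35
    mid-adj {b = suc zero} {zero} _ = inj₂ c34
    mid-adj {b = suc zero} {suc zero} b≢b′ = ⊥-elim (b≢b′ refl)
    mid-adj {b = suc zero} {suc (suc zero)} _ = inj₁ c45
    mid-adj {b = suc (suc zero)} {zero} _ = inj₂ c35
    mid-adj {b = suc (suc zero)} {suc zero} _ = inj₂ c45
    mid-adj {b = suc (suc zero)} {suc (suc zero)} b≢b′ = ⊥-elim (b≢b′ refl)

    relabel-edge : ∀ ρ {u v} → Edge S u v → Adj S (relabel ρ u) (relabel ρ v)
    relabel-edge ρ x12 = inj₁ x12
    relabel-edge ρ x13 = inj₁ x13
    relabel-edge ρ x14 = inj₁ x14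
    relabel-edge ρ x15 = inj₁ x15
    relabel-edge ρ x23 = inj₁ x23
    relabel-edge ρ x24 = inj₁ x24
    relabel-edge ρ x25 = inj₁ x25
    relabel-edge ρ x34 = inj₁ x34
    relabel-edge ρ x35 = inj₁ x35
    relabel-edge ρ (cab {j} a b)
      rewrite permuteMid-low (ρ j) a | permuteMid-mid (ρ j) b = inj₁ (cab a (ρ j ⟨$⟩ʳ b))
    relabel-edge ρ (c34 {j}) = mid-adj (permute-≢ (ρ j) λ ())
    relabel-edge ρ (c35 {j}) = mid-adj (permute-≢ (ρ j) λ ())
    relabel-edge ρ (c45 {j}) = mid-adj (permute-≢ (ρ j) λ ())
    relabel-edge ρ (c6b {j} b) rewrite permuteMid-mid (ρ j) b = inj₁ (c6b (ρ j ⟨$⟩ʳ b))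
    relabel-edge ρ (pos11 p) = inj₁ (pos11 p)
    relabel-edge ρ (pos21 p) = inj₁ (pos21 p)
    relabel-edge ρ (pos22 p) = inj₁ (pos22 p)
    relabel-edge ρ (neg11 p) = inj₁ (neg11 p)
    relabel-edge ρ (neg12 p) = inj₁ (neg12 p)
    relabel-edge ρ (neg22 p) = inj₁ (neg22 p)
    relabel-edge ρ (cc {j} {j′} j≢j′ a b)
      rewrite permuteMid-low (ρ j) a | permuteMid-low (ρ j′) b = inj₁ (cc j≢j′ a b)

    relabel-hom : ∀ ρ {u v} → Adj S u v → Adj S (relabel ρ u) (relabel ρ v)
    relabel-hom ρ = [ relabel-edge ρ , swap ∘ relabel-edge ρ ]

    edgeKind : ∀ {u v} → Edge S u v → EdgeKind u v
    edgeKind x12 = outer tt tt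
    edgeKind x13 = outer tt tt
    edgeKind x14 = outer tt tt
    edgeKind x15 = outer tt tt
    edgeKind x23 = outer tt tt
    edgeKind x24 = outer tt tt
    edgeKind x25 = outer tt tt
    edgeKind x34 = outer tt tt
    edgeKind x35 = outer tt tt
    edgeKind (cab a b) = gadget (inj₂ (b , refl))
    edgeKind c34 = gadget (inj₁ (# 0 , refl))
    edgeKind c35 = gadget (inj₁ (# 0 , refl))
    edgeKind c45 = gadget (inj₁ (# 1 , refl))
    edgeKind (c6b b) = gadget (inj₂ (b , refl))
    edgeKind (pos11 _) = outer (# 0 , refl) tt
    edgeKind (pos21 _) = outer (# 1 , refl) tt
    edgeKind (pos22 _) = outer (# 1 , refl) tt
    edgeKind (neg11 _) = outer (# 0 , refl) tt
    edgeKind (neg12 _) = outer (# 0 , refl) tt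
    edgeKind (neg22 _) = outer (# 1 , refl) tt
    edgeKind (cc _ a b) = outer (a , refl) (b , refl)

    adjKind : ∀ {u v} → Adj S u v → EdgeKind u v
    adjKind = [ edgeKind , EdgeKind-sym ∘ edgeKind ]

module Gadget {n m : ℕ} (S : Fin m → Clause n) (j : Fin m) where

  open Connectivity (Adj S)

  cmid : Fin 3 → Vtx n m
  cmid t = c j (mid t)

  c³ c⁴ c⁵ c⁶ : Vtx n m
  c³ = cmid (# 0)
  c⁴ = cmid (# 1)
  c⁵ = cmid (# 2)
  c⁶ = c j (# 5)

  cmid≢c⁶ : ∀ b → cmid b ≢ c⁶
  cmid≢c⁶ zero ()
  cmid≢c⁶ (suc zero) ()
  cmid≢c⁶ (suc (suc zero)) ()

  c³-neighbour-in-gadget : ∀ {u} → Adj S u c³ → ∃ λ a → u ≡ c j a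
  c³-neighbour-in-gadget adj with adjKind S adj
  ... | outer _ (zero , ())
  ... | outer _ (suc _ , ())
  ... | gadget _ = _ , refl

  c⁶-neighbour-in-triangle : ∀ {u} → Adj S u c⁶ → ∃ λ b → u ≡ cmid b
  c⁶-neighbour-in-triangle adj with adjKind S adj
  ... | outer _ (zero , ())
  ... | outer _ (suc _ , ())
  ... | gadget (inj₁ (b , refl)) = b , refl
  ... | gadget (inj₂ (zero , ()))
  ... | gadget (inj₂ (suc zero , ()))
  ... | gadget (inj₂ (suc (suc zero) , ()))

  module Swap (s t : Fin 3) where

    σ : Vtx n m → Vtx n m
    σ = relabel (swapAt j s t)

    σ⁻¹ : Vtx n m → Vtx n m
    σ⁻¹ = relabel (flip ∘ swapAt j s t)

    open Automorphism {A = Adj S} σ σ⁻¹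
      (relabel-inverse _) (relabel-inverse _) (relabel-hom S _) (relabel-hom S _) public

    swap-moves : σ (cmid s) ≡ cmid t
    swap-moves rewrite dec-true (j ≟ᶠ j) refl =
      cong (c j) (trans (permuteMid-mid _ s) (cong mid (transpose-matchˡ s t)))

    swap-fixes : ∀ {v} → v ≢ cmid s → v ≢ cmid t → σ v ≡ v
    swap-fixes {x i a} _ _ = refl
    swap-fixes {c j′ a} v≢s v≢t with j′ ≟ᶠ j
    ... | no _ = cong (c j′) (permuteMid-fixes id a λ _ _ → refl)
    ... | yes refl = cong (c j) (permuteMid-fixes (transpose s t) a λ b mid-b≡a →
      transpose-fixes (λ { refl → v≢s (cong (c j) (sym mid-b≡a)) })
                      (λ { refl → v≢t (cong (c j) (sym mid-b≡a)) }))

  κ-swap : ∀ s t {v a} → v ≢ cmid s → v ≢ cmid t →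
           κ (Adj S) v (cmid s) a → κ (Adj S) v (cmid t) a
  κ-swap s t {a = a} v≢s v≢t κv =
    subst₂ (λ v′ w′ → κ (Adj S) v′ w′ a) (swap-fixes v≢s v≢t) swap-moves (κ-invariant κv)
    where open Swap s t

  resolving⇒one-of-two-mids : ∀ {k} {W : Fin k → Vtx n m} {s t} → Resolving (Adj S) W →
                              s ≢ t → ¬ cmid s ∈W W → cmid t ∈W W
  resolving⇒one-of-two-mids {W = W} {s} {t} resolving s≢t s∉W with cmid t ∈W? W
  ... | yes t∈W = t∈W
  ... | no t∉W = ⊥-elim (s≢t (mid-injective (c-injectiveʳ
          (trans (sym (resolving⇒fixes-all resolving fixes-W (cmid s))) swap-moves))))
    where
    open Swap s t
    fixes-W : ∀ i → σ (W i) ≡ W i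
    fixes-W i = swap-fixes (λ eq → s∉W (i , eq)) (λ eq → t∉W (i , eq))

  -- c¹, c², c⁴, c⁶: the common neighbours of c³ and c⁵
  c³c⁵-fan : Fin 4 → Vtx n m
  c³c⁵-fan = c j ∘ punchIn (# 2) ∘ punchIn (# 3)

  c³c⁵-spoke : ∀ t → Adj S c⁵ (c³c⁵-fan t) × Adj S (c³c⁵-fan t) c³ ×
                      c⁵ ≢ c³c⁵-fan t × c³c⁵-fan t ≢ c³
  c³c⁵-spoke zero = inj₂ (cab (# 0) (# 2)) , inj₁ (cab (# 0) (# 0)) , (λ ()) , (λ ())
  c³c⁵-spoke (suc zero) = inj₂ (cab (# 1) (# 2)) , inj₁ (cab (# 1) (# 0)) , (λ ()) , (λ ())
  c³c⁵-spoke (suc (suc zero)) = inj₂ c45 , inj₂ c34 , (λ ()) , (λ ())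
  c³c⁵-spoke (suc (suc (suc zero))) = inj₂ (c6b (# 2)) , inj₁ (c6b (# 0)) , (λ ()) , (λ ())

  c³-neighbours-covered : ∀ {u} → Adj S u c³ → u ≢ c³ → ∃ λ t → c j (punchIn (# 2) t) ≡ u
  c³-neighbours-covered adj u≢c³ with c³-neighbour-in-gadget adj
  ... | a , refl = punchOut 2≢a , cong (c j) (punchIn-punchOut 2≢a)
    where
    2≢a : # 2 ≢ a
    2≢a refl = u≢c³ refl

  κ-c⁵-c³ : κ (Adj S) c⁵ c³ (fin 5)
  κ-c⁵-c³ = κ-max (λ ())
    (fan⇒disjointPaths (λ ()) (inj₂ c35) c³c⁵-fan
      (punchIn-injective (# 3) _ _ ∘ punchIn-injective (# 2) _ _ ∘ c-injectiveʳ) c³c⁵-spoke)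
    (λ _ → neighbours⇒disjointPaths≤ (c j ∘ punchIn (# 2)) c³-neighbours-covered)

  κ-c⁵-c⁴ : κ (Adj S) c⁵ c⁴ (fin 5)
  κ-c⁵-c⁴ = κ-swap (# 0) (# 1) (λ ()) (λ ()) κ-c⁵-c³

  c⁶-cut : Cut (lookupᵥ (c⁴ ∷ c⁵ ∷ c⁶ ∷ [])) c⁶ c³
  c⁶-cut {[]} _ = # 2 , inj₂ (refl , refl)
  c⁶-cut {u ∷ I} path@(c⁶u ∷ _ , _) with c⁶-neighbour-in-triangle (swap c⁶u)
  ... | zero , refl = ⊥-elim (end∉interior {I = u ∷ I} path (here refl))
  ... | suc zero , refl = # 0 , inj₁ (here refl)
  ... | suc (suc zero) , refl = # 1 , inj₁ (here refl)

  c³-separator : Fin 4 → Vtx n m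
  c³-separator = lookupᵥ (c j (# 0) ∷ c j (# 1) ∷ c⁴ ∷ c⁵ ∷ [])

  c³-separator-covers : ∀ a → c j a ≢ c³ → c j a ≢ c⁶ → ∃ λ t → c³-separator t ≡ c j a
  c³-separator-covers zero _ _ = # 0 , refl
  c³-separator-covers (suc zero) _ _ = # 1 , refl
  c³-separator-covers (suc (suc zero)) ≢c³ _ = ⊥-elim (≢c³ refl)
  c³-separator-covers (suc (suc (suc zero))) _ _ = # 2 , refl
  c³-separator-covers (suc (suc (suc (suc zero)))) _ _ = # 3 , refl
  c³-separator-covers (suc (suc (suc (suc (suc zero))))) _ ≢c⁶ = ⊥-elim (≢c⁶ refl)

  interior-meets-c³-separator : ∀ {v I a} → IsPath (Adj S) v c³ I → c j a ∈ I → c j a ≢ c⁶ →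
                               Meets c³-separator v I
  interior-meets-c³-separator {I = I} {a} path ∈I ≢c⁶ =
    let t , e = c³-separator-covers a (λ { refl → end∉interior {I = I} path ∈I }) ≢c⁶
    in t , inj₁ (subst (_∈ I) (sym e) ∈I)

  -- A path entering c³ from c⁶ reaches c⁶ from c⁴ or c⁵, as its start v is not a mid vertex.
  c³-cut : ∀ {v} → (∀ b → v ≢ cmid b) → v ≢ c⁶ → Cut c³-separator v c³
  c³-cut v∉mid v≢c⁶ {I₀} path@(linked , _) with lastStep I₀ linked
  ... | direct vc³ with c³-neighbour-in-gadget vc³
  ...   | a , refl = let t , e = c³-separator-covers a (v∉mid (# 0)) v≢c⁶ in t , inj₂ (refl , e)
  c³-cut v∉mid v≢c⁶ path | via I {u} linked′ uc³ with c³-neighbour-in-gadget uc³ | u ≟ᵥ c⁶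
  ... | _ , refl | no u≢c⁶ = interior-meets-c³-separator path (∈-++⁺ʳ I (here refl)) u≢c⁶
  ... | _ , refl | yes refl with lastStep I linked′
  ...   | direct vc⁶ = let b , v≡ = c⁶-neighbour-in-triangle vc⁶ in ⊥-elim (v∉mid b v≡)
  ...   | via I′ _ qc⁶ with c⁶-neighbour-in-triangle qc⁶
  ...     | b , refl = interior-meets-c³-separator path (∈-++⁺ˡ (∈-++⁺ʳ I′ (here refl))) (cmid≢c⁶ b)

  non-mid⇒¬5-paths-to-c³ : ∀ {v} → (∀ b → v ≢ cmid b) → ¬ DisjointPaths (Adj S) v c³ 5
  non-mid⇒¬5-paths-to-c³ {v} v∉mid ps with v ≟ᵥ c⁶
  ... | yes refl = 5≰3 (cut⇒disjointPaths≤ _ c⁶-cut ps)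
    where
    5≰3 : ¬ 5 ≤ 3
    5≰3 (s≤s (s≤s (s≤s ())))
  ... | no v≢c⁶ = 5≰4 (cut⇒disjointPaths≤ _ (c³-cut v∉mid v≢c⁶) ps)
    where
    5≰4 : ¬ 5 ≤ 4
    5≰4 (s≤s (s≤s (s≤s (s≤s ()))))

  κ-c⁴-defined : ∀ {v b} → κ (Adj S) v c⁵ b → ∃ λ b′ → κ (Adj S) v c⁴ b′
  κ-c⁴-defined {v} κv with v ≟ᵥ c⁴ | v ≟ᵥ c⁵
  ... | yes refl | _ = ∞ , κ-refl
  ... | no _ | yes refl = fin 5 , κ-c⁵-c⁴
  ... | no v≢c⁴ | no v≢c⁵ = _ , κ-swap (# 2) (# 1) v≢c⁵ v≢c⁴ κv

  agree-c⁴⇒≡ : ∀ {v b} → Agree c⁴ v c⁴ → κ (Adj S) v c⁵ b → c⁴ ≡ v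
  agree-c⁴⇒≡ agree₄ κv = sym (agree-at-self⇒≡ agree₄ (proj₂ (κ-c⁴-defined κv)))

  agree-c⁵⇒≡ : ∀ {v b} → Agree c⁵ v c³ → Agree c⁵ v c⁴ → κ (Adj S) v c⁵ b → c⁵ ≡ v
  agree-c⁵⇒≡ {v} {b} agree₃ agree₄ κv with v ≟ᵥ c⁵ | v ≟ᵥ c³ | v ≟ᵥ c⁴
  ... | yes refl | _ | _ = refl
  ... | no _ | yes refl | _ = agree-at-self⇒≡ (Agree-sym agree₃) κ-c⁵-c³
  ... | no _ | no _ | yes refl = agree-at-self⇒≡ (Agree-sym agree₄) κ-c⁵-c⁴
  ... | no v≢c⁵ | no v≢c³ | no v≢c⁴ =
    ⊥-elim (non-mid⇒¬5-paths-to-c³ v∉mid (κ-fin⇒disjointPaths (subst (κ (Adj S) v c³) five≡ κv³)))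
    where
    κv³ : κ (Adj S) v c³ b
    κv³ = κ-swap (# 2) (# 0) v≢c⁵ v≢c³ κv

    five≡ : b ≡ fin 5
    five≡ = sym (agree₃ _ _ κ-c⁵-c³ κv³)

    v∉mid : ∀ b → v ≢ cmid b
    v∉mid zero = v≢c³
    v∉mid (suc zero) = v≢c⁴
    v∉mid (suc (suc zero)) = v≢c⁵

  agree-c³-c⁴⇒≡ : ∀ {u v b} → Agree u v c³ → Agree u v c⁴ → κ (Adj S) v c⁵ b →
           u ≡ c⁴ ⊎ u ≡ c⁵ → u ≡ v
  agree-c³-c⁴⇒≡ _ agree₄ κv (inj₁ refl) = agree-c⁴⇒≡ agree₄ κv
  agree-c³-c⁴⇒≡ agree₃ agree₄ κv (inj₂ refl) = agree-c⁵⇒≡ agree₃ agree₄ κv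

  agree-c³-c⁴⇒agree-c⁵ : ∀ {u v} → Agree u v c³ → Agree u v c⁴ → Agree u v c⁵
  agree-c³-c⁴⇒agree-c⁵ {u} {v} agree₃ agree₄ a b κu κv
    with u ≟ᵥ c⁴ ⊎-dec u ≟ᵥ c⁵ | v ≟ᵥ c⁴ ⊎-dec v ≟ᵥ c⁵
  ... | yes u∈ | _ = ≡⇒Agree (agree-c³-c⁴⇒≡ agree₃ agree₄ κv u∈) a b κu κv
  ... | no _ | yes v∈ =
    Agree-sym (≡⇒Agree (agree-c³-c⁴⇒≡ (Agree-sym agree₃) (Agree-sym agree₄) κu v∈)) a b κu κv
  ... | no u∉ | no v∉ = agree₄ a b (κ-swap (# 2) (# 1) (u∉ ∘ inj₂) (u∉ ∘ inj₁) κu)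
                                   (κ-swap (# 2) (# 1) (v∉ ∘ inj₂) (v∉ ∘ inj₁) κv)

  basis⇒¬all-mids : ∀ {k} {W : Fin k → Vtx n m} → ConnectivityBasis (Adj S) W →
                    ¬ (∀ t → cmid t ∈W W)
  basis⇒¬all-mids {k} {W} basis mids∈W = basis-irredundant basis p redundant
    where
    p : Fin k
    p = proj₁ (mids∈W (# 2))

    W-p≡c⁵ : W p ≡ c⁵
    W-p≡c⁵ = proj₂ (mids∈W (# 2))

    redundant : ∀ u v → (∀ i → p ≢ i → Agree u v (W i)) → Agree u v (W p)
    redundant u v agree = subst (Agree u v) (sym W-p≡c⁵)
      (agree-c³-c⁴⇒agree-c⁵ (agree-at (# 0) (λ ())) (agree-at (# 1) (λ ())))
      where
      agree-at : ∀ t → c⁵ ≢ cmid t → Agree u v (cmid t)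
      agree-at t c⁵≢ =
        let i , W-i≡ = mids∈W t
        in subst (Agree u v) W-i≡
             (agree i λ p≡i → c⁵≢ (trans (sym W-p≡c⁵) (trans (cong W p≡i) W-i≡)))

lemma4p1 : ∀ {n m : ℕ} (S : Fin m → Clause n) →
           AllVarsOccur S → Connected (Adj S) →
           ∀ {k} (W : Fin k → Vtx n m) → ConnectivityBasis (Adj S) W →
           ∀ (j : Fin m) → ExactlyTwoMid W j
lemma4p1 S _ _ W basis@(_ , resolving , _) j =
  let t , t∉W = ¬∀⟶∃¬ 3 _ (λ t → cmid t ∈W? W) (basis⇒¬all-mids basis)
  in t , t∉W , λ t′ t′≢t → resolving⇒one-of-two-mids resolving (≢-sym t′≢t) t∉W
  where open Gadget S j
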